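{- Let $r$ and $t$ be positive integers with $t\le r/2$ and $t$ odd. If $r$ is even or $r\ge (t+2)(t+1)$, then there exists an $r$-regular graph that is not $(r-t,t)$-colorable.
   Context: All graphs are finite, undirected pseudographs (multiple edges and loops allowed; a loop contributes $2$ to the degree). An $(r-t,t)$-coloring of an $r$-regular graph is an edge-coloring using at least two colors such that every vertex is incident to exactly $r-t$ edges of one color and exactly $t$ edges of a different color. -}

module Defs where

open import Data.Nat using (ℕ; zero; suc; _+_; _*_)
open import Data.Nat.ListAction using (sum)
open import Data.Fin using (Fin) renaming (_≟_ to _≟ᶠ_)
open import Data.Nat using () renaming (_≟_ to _≟ⁿ_)
open import Data.Product using (Σ; _×_; _,_; ∃)
open import Data.List using (List; map; allFin)
open import Relation.Nullary using (¬_; Dec; yes; no)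
open import Relation.Binary.PropositionalEquality using (_≡_)

-- A finite pseudograph: vertices Fin n, edges Fin m, each edge has two
-- endpoints (equal endpoints = a loop). Multiple edges are allowed.
record Pseudograph : Set where
  field
    nV  : ℕ
    nE  : ℕ
    ends : Fin nE → Fin nV × Fin nV
open Pseudograph public

one-if : {A : Set} → Dec A → ℕ
one-if (yes _) = 1
one-if (no _)  = 0

-- number of ends of edge e at vertex v (0, 1 or 2; a loop counts 2)
incidence : (G : Pseudograph) → Fin (nV G) → Fin (nE G) → ℕ
incidence G v e with ends G e
... | (x , y) = one-if (v ≟ᶠ x) + one-if (v ≟ᶠ y)

degree : (G : Pseudograph) → Fin (nV G) → ℕ
degree G v = sum (map (incidence G v) (allFin (nE G)))

Regular : ℕ → Pseudograph → Set
Regular r G = ∀ v → degree G v ≡ r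

Coloring : Pseudograph → Set
Coloring G = Fin (nE G) → ℕ

colorDegree : (G : Pseudograph) → Coloring G → Fin (nV G) → ℕ → ℕ
colorDegree G c v a =
  sum (map (λ e → one-if (c e ≟ⁿ a) * incidence G v e) (allFin (nE G)))

IsColoring : (p q : ℕ) (G : Pseudograph) → Coloring G → Set
IsColoring p q G c =
  (Σ (Fin (nE G)) λ e₁ → Σ (Fin (nE G)) λ e₂ → ¬ (c e₁ ≡ c e₂)) ×
  (∀ v → Σ ℕ λ a → Σ ℕ λ b → ¬ (a ≡ b) ×
     colorDegree G c v a ≡ p × colorDegree G c v b ≡ q)

Colorable : (p q : ℕ) → Pseudograph → Set
Colorable p q G = Σ (Coloring G) (IsColoring p q G)

-- For even r, a bouquet of r/2 loops works: every colour degree is even, while t is odd.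
-- For odd r, join a centre to t + 1 leaves by t + 2 parallel edges each and to one further leaf by the
-- remaining r − (t + 1)(t + 2) edges, and fill every leaf up to degree r with loops. Loops contribute
-- evenly, so at a leaf with t + 2 spokes the colour of degree t sits on an odd, hence positive, number
-- of spokes, but not on all of them. So every colour misses a spoke at each of these t + 1 leaves and
-- has degree at most r − t − 1 at the centre.
module Submission where

open import Defs
open import Data.Nat using (ℕ; _+_; _*_; _∸_; _≤_; _<_)
open import Data.Nat.Divisibility using (_∣_)
open import Data.Fin using (Fin)
open import Data.Product using (Σ; _×_)
open import Data.Sum using (_⊎_)
open import Relation.Nullary using (¬_)

open import Data.Nat using (zero; suc; z≤n; s≤s; _/_; _%_) renaming (_≟_ to _≟ⁿ_)
open import Data.Nat.Properties
  using (+-*-semiring; +-assoc; +-identityʳ; *-identityʳ; *-zeroʳ; +-mono-≤; ≤-trans;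
         m≤n⇒m≤1+n; m≤m+n; m≤n+m; m+n∸n≡m; n≮n; ≤-pred; m≤n⇒∃[o]m+o≡n; module ≤-Reasoning)
open import Data.Nat.Divisibility using (divides; _∣?_; ∣m∣n⇒∣m+n; m%n≡0⇒n∣m)
open import Data.Nat.DivMod using (m≡m%n+[m/n]*n; m%n<n)
open import Data.Nat.Tactic.RingSolver using (solve-∀)
import Data.Nat.ListAction as ListAction
open import Data.Fin using (_↑ˡ_; _↑ʳ_) renaming (zero to fzero; suc to fsuc; _≟_ to _≟ᶠ_)
open import Data.Fin.Properties using (punchInᵢ≢i) renaming (suc-injective to fsuc-injective)
import Data.List as List
open import Data.Vec.Functional using (_++_; removeAt)
open import Data.Vec.Functional.Properties using (lookup-++ˡ; lookup-++ʳ)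
open import Data.Product using (_,_; ∃)
open import Data.Sum using (inj₁; inj₂)
open import Data.Empty using (⊥-elim)
open import Relation.Nullary using (yes; no)
open import Relation.Binary.PropositionalEquality
open import Function using (_∘_; id)
open import Algebra.Properties.Semiring.Sum +-*-semiring
  using (sum; sum-cong-≗; sum-remove; sum-replicate-zero; *-distribʳ-sum)

sum-map-tabulate : ∀ {A : Set} {n} (h : A → ℕ) (g : Fin n → A) →
  ListAction.sum (List.map h (List.tabulate g)) ≡ sum (h ∘ g)
sum-map-tabulate {n = zero} h g = refl
sum-map-tabulate {n = suc n} h g = cong (h (g fzero) +_) (sum-map-tabulate h (g ∘ fsuc))

sum-↑ : ∀ m {n} (f : Fin (m + n) → ℕ) → sum f ≡ sum (f ∘ (_↑ˡ n)) + sum (f ∘ (m ↑ʳ_))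
sum-↑ zero f = refl
sum-↑ (suc m) f = trans (cong (f fzero +_) (sum-↑ m (f ∘ fsuc))) (sym (+-assoc (f fzero) _ _))

sum-const : ∀ n k → sum {n} (λ _ → k) ≡ n * k
sum-const zero k = refl
sum-const (suc n) k = cong (k +_) (sum-const n k)

sum-mono : ∀ {n} {f g : Fin n → ℕ} → (∀ i → f i ≤ g i) → sum f ≤ sum g
sum-mono {zero} f≤g = z≤n
sum-mono {suc n} f≤g = +-mono-≤ (f≤g fzero) (sum-mono (f≤g ∘ fsuc))

sum-single : ∀ {n} (f : Fin n → ℕ) i → (∀ j → j ≢ i → f j ≡ 0) → sum f ≡ f i
sum-single {suc n} f i vanish = begin
  sum f                      ≡⟨ sum-remove {i = i} f ⟩
  f i + sum (removeAt f i)   ≡⟨ cong (f i +_) (sum-cong-≗ (λ j → vanish _ (punchInᵢ≢i i j))) ⟩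
  f i + sum {n} (λ _ → 0)    ≡⟨ cong (f i +_) (sum-replicate-zero n) ⟩
  f i + 0                    ≡⟨ +-identityʳ (f i) ⟩
  f i                        ∎
  where open ≡-Reasoning

2∣sum-*2 : ∀ {n} (f : Fin n → ℕ) → 2 ∣ sum (λ i → f i * 2)
2∣sum-*2 f = divides (sum f) (sym (*-distribʳ-sum 2 f))

count : ∀ {n} → (Fin n → ℕ) → ℕ → ℕ
count c a = sum (λ i → one-if (c i ≟ⁿ a))

count≤n : ∀ {n} (c : Fin n → ℕ) a → count c a ≤ n
count≤n {zero} c a = z≤n
count≤n {suc n} c a with c fzero ≟ⁿ a
... | yes _ = s≤s (count≤n (c ∘ fsuc) a)
... | no _ = m≤n⇒m≤1+n (count≤n (c ∘ fsuc) a)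

Nonconstant : ∀ {n} → (Fin n → ℕ) → Set
Nonconstant c = ∀ a → ∃ λ i → c i ≢ a

count<n : ∀ {n} (c : Fin n → ℕ) a i → c i ≢ a → count c a < n
count<n {suc n} c a fzero ci≢a with c fzero ≟ⁿ a
... | yes ci≡a = ⊥-elim (ci≢a ci≡a)
... | no _ = s≤s (count≤n (c ∘ fsuc) a)
count<n {suc n} c a (fsuc i) ci≢a with c fzero ≟ⁿ a
... | yes _ = s≤s (count<n (c ∘ fsuc) a i ci≢a)
... | no _ = m≤n⇒m≤1+n (count<n (c ∘ fsuc) a i ci≢a)

count≢0⇒∈ : ∀ {n} (c : Fin n → ℕ) a → count c a ≢ 0 → ∃ λ i → c i ≡ a
count≢0⇒∈ {zero} c a count≢0 = ⊥-elim (count≢0 refl)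
count≢0⇒∈ {suc n} c a count≢0 with c fzero ≟ⁿ a
... | yes c0≡a = fzero , c0≡a
... | no _ with count≢0⇒∈ (c ∘ fsuc) a count≢0
... | i , ci≡a = fsuc i , ci≡a

count<n⇒∉ : ∀ {n} (c : Fin n → ℕ) a → count c a < n → ∃ λ i → c i ≢ a
count<n⇒∉ {suc n} c a count<n with c fzero ≟ⁿ a
... | no c0≢a = fzero , c0≢a
... | yes _ with count<n⇒∉ (c ∘ fsuc) a (≤-pred count<n)
... | i , ci≢a = fsuc i , ci≢a

odd-count<n⇒nonconstant : ∀ {n} (c : Fin n → ℕ) b → ¬ 2 ∣ count c b → count c b < n → Nonconstant c
odd-count<n⇒nonconstant c b odd small a with b ≟ⁿ a
... | yes refl = count<n⇒∉ c b small
... | no b≢a with count≢0⇒∈ c b (λ count≡0 → odd (subst (2 ∣_) (sym count≡0) (divides 0 refl)))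
... | i , ci≡b = i , λ ci≡a → b≢a (trans (sym ci≡b) ci≡a)

Edges : ℕ → ℕ → Set
Edges V k = Fin k → Fin V × Fin V

graph : ∀ {V k} → Edges V k → Pseudograph
graph {V} {k} es = record { nV = V ; nE = k ; ends = es }

inc : ∀ {V} → Fin V → Fin V × Fin V → ℕ
inc v (x , y) = one-if (v ≟ᶠ x) + one-if (v ≟ᶠ y)

one-if-≟-refl : ∀ {V} (v : Fin V) → one-if (v ≟ᶠ v) ≡ 1
one-if-≟-refl v with v ≟ᶠ v
... | yes _ = refl
... | no v≢v = ⊥-elim (v≢v refl)

one-if-≟-≢ : ∀ {V} {v u : Fin V} → v ≢ u → one-if (v ≟ᶠ u) ≡ 0
one-if-≟-≢ {v = v} {u} v≢u with v ≟ᶠ u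
... | yes v≡u = ⊥-elim (v≢u v≡u)
... | no _ = refl

weightedDegree : ∀ {V k} → Edges V k → (Fin k → ℕ) → Fin V → ℕ
weightedDegree es w v = sum (λ e → w e * inc v (es e))

degree≡weightedDegree : ∀ {V k} (es : Edges V k) v → degree (graph es) v ≡ weightedDegree es (λ _ → 1) v
degree≡weightedDegree {k = k} es v =
  trans (sum-map-tabulate {n = k} (incidence (graph es) v) id) (sum-cong-≗ (λ e → sym (+-identityʳ (inc v (es e)))))

colorDegree≡weightedDegree : ∀ {V k} (es : Edges V k) c v a →
  colorDegree (graph es) c v a ≡ weightedDegree es (λ e → one-if (c e ≟ⁿ a)) v
colorDegree≡weightedDegree {k = k} es c v a =
  sum-map-tabulate {n = k} (λ e → one-if (c e ≟ⁿ a) * incidence (graph es) v e) id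

weightedDegree-++ : ∀ {V k l} (es : Edges V k) (fs : Edges V l) w v →
  weightedDegree (es ++ fs) w v ≡ weightedDegree es (w ∘ (_↑ˡ l)) v + weightedDegree fs (w ∘ (k ↑ʳ_)) v
weightedDegree-++ {k = k} {l} es fs w v = trans (sum-↑ k _) (cong₂ _+_
  (sum-cong-≗ (λ e → cong (λ p → w (e ↑ˡ l) * inc v p) (lookup-++ˡ es fs e)))
  (sum-cong-≗ (λ e → cong (λ p → w (k ↑ʳ e) * inc v p) (lookup-++ʳ es fs e))))

bundles : ∀ {V g} (n : Fin g → ℕ) → (Fin g → Fin V × Fin V) → Edges V (sum n)
bundles {g = zero} n p ()
bundles {g = suc g} n p = (λ _ → p fzero) ++ bundles (n ∘ fsuc) (p ∘ fsuc)

inject : ∀ {g} (n : Fin g → ℕ) (j : Fin g) → Fin (n j) → Fin (sum n)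
inject n fzero i = i ↑ˡ _
inject n (fsuc j) i = n fzero ↑ʳ inject (n ∘ fsuc) j i

weightedDegree-bundles : ∀ {V g} (n : Fin g → ℕ) (p : Fin g → Fin V × Fin V) w v →
  weightedDegree (bundles n p) w v ≡ sum (λ j → sum (λ i → w (inject n j i)) * inc v (p j))
weightedDegree-bundles {g = zero} n p w v = refl
weightedDegree-bundles {V} {suc g} n p w v = trans
  (weightedDegree-++ {l = sum (n ∘ fsuc)} (λ _ → p fzero) (bundles (n ∘ fsuc) (p ∘ fsuc)) w v)
  (cong₂ _+_
    (sym (*-distribʳ-sum (inc v (p fzero)) (λ i → w (i ↑ˡ sum (n ∘ fsuc)))))
    (weightedDegree-bundles (n ∘ fsuc) (p ∘ fsuc) (w ∘ (n fzero ↑ʳ_)) v))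

-- Vertex 0 is the centre; leaf j (vertex suc j) is joined to it by m j parallel edges and carries l j loops.
module Star {g} (m l : Fin g → ℕ) where

  spokes : Edges (suc g) (sum m)
  spokes = bundles m (λ j → fzero , fsuc j)

  loops : Edges (suc g) (sum l)
  loops = bundles l (λ j → fsuc j , fsuc j)

  star : Pseudograph
  star = graph (spokes ++ loops)

  spoke : (j : Fin g) → Fin (m j) → Fin (nE star)
  spoke j i = inject m j i ↑ˡ sum l

  loop : (j : Fin g) → Fin (l j) → Fin (nE star)
  loop j i = sum m ↑ʳ inject l j i

  spokeWeight loopWeight : (Fin (nE star) → ℕ) → Fin g → ℕ
  spokeWeight w j = sum (λ i → w (spoke j i))
  loopWeight w j = sum (λ i → w (loop j i))

  weightedDegree-centre : ∀ w → weightedDegree (ends star) w fzero ≡ sum (spokeWeight w)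
  weightedDegree-centre w = begin
    weightedDegree (ends star) w fzero
      ≡⟨ weightedDegree-++ spokes loops w fzero ⟩
    weightedDegree spokes (w ∘ (_↑ˡ sum l)) fzero + weightedDegree loops (w ∘ (sum m ↑ʳ_)) fzero
      ≡⟨ cong₂ _+_ (weightedDegree-bundles m _ (w ∘ (_↑ˡ sum l)) fzero)
                   (weightedDegree-bundles l _ (w ∘ (sum m ↑ʳ_)) fzero) ⟩
    sum (λ j → spokeWeight w j * 1) + sum (λ j → loopWeight w j * 0)
      ≡⟨ cong₂ _+_ (sum-cong-≗ (λ j → *-identityʳ (spokeWeight w j)))
                   (trans (sum-cong-≗ (λ j → *-zeroʳ (loopWeight w j))) (sum-replicate-zero g)) ⟩
    sum (spokeWeight w) + 0
      ≡⟨ +-identityʳ _ ⟩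
    sum (spokeWeight w)  ∎
    where open ≡-Reasoning

  weightedDegree-leaf : ∀ w k → weightedDegree (ends star) w (fsuc k) ≡ spokeWeight w k + loopWeight w k * 2
  weightedDegree-leaf w k = begin
    weightedDegree (ends star) w (fsuc k)
      ≡⟨ weightedDegree-++ spokes loops w (fsuc k) ⟩
    weightedDegree spokes (w ∘ (_↑ˡ sum l)) (fsuc k) + weightedDegree loops (w ∘ (sum m ↑ʳ_)) (fsuc k)
      ≡⟨ cong₂ _+_ (weightedDegree-bundles m _ (w ∘ (_↑ˡ sum l)) (fsuc k))
                   (weightedDegree-bundles l _ (w ∘ (sum m ↑ʳ_)) (fsuc k)) ⟩
    sum (λ j → spokeWeight w j * δ j) + sum (λ j → loopWeight w j * (δ j + δ j))
      ≡⟨ cong₂ _+_ (sum-single _ k (λ j j≢k → trans (cong (λ x → spokeWeight w j * x) (δ≢ j j≢k)) (*-zeroʳ (spokeWeight w j))))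
                   (sum-single _ k (λ j j≢k → trans (cong (λ x → loopWeight w j * (x + x)) (δ≢ j j≢k)) (*-zeroʳ (loopWeight w j)))) ⟩
    spokeWeight w k * δ k + loopWeight w k * (δ k + δ k)
      ≡⟨ cong₂ _+_ (trans (cong (spokeWeight w k *_) (one-if-≟-refl (fsuc k))) (*-identityʳ _))
                   (cong (λ x → loopWeight w k * (x + x)) (one-if-≟-refl (fsuc k))) ⟩
    spokeWeight w k + loopWeight w k * 2  ∎
    where
    open ≡-Reasoning
    δ : Fin g → ℕ
    δ j = one-if (fsuc k ≟ᶠ fsuc j)
    δ≢ : ∀ j → j ≢ k → δ j ≡ 0
    δ≢ j j≢k = one-if-≟-≢ (j≢k ∘ sym ∘ fsuc-injective)

  degree-centre : degree star fzero ≡ sum m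
  degree-centre = trans (degree≡weightedDegree (ends star) fzero)
    (trans (weightedDegree-centre (λ _ → 1)) (sum-cong-≗ (λ j → trans (sum-const (m j) 1) (*-identityʳ (m j)))))

  degree-leaf : ∀ k → degree star (fsuc k) ≡ m k + l k * 2
  degree-leaf k = trans (degree≡weightedDegree (ends star) (fsuc k))
    (trans (weightedDegree-leaf (λ _ → 1) k)
      (cong₂ _+_ (trans (sum-const (m k) 1) (*-identityʳ (m k))) (cong (_* 2) (trans (sum-const (l k) 1) (*-identityʳ (l k))))))

  colorDegree-centre : ∀ c a → colorDegree star c fzero a ≡ sum (λ j → count (c ∘ spoke j) a)
  colorDegree-centre c a = trans (colorDegree≡weightedDegree (ends star) c fzero a) (weightedDegree-centre (λ e → one-if (c e ≟ⁿ a)))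

  colorDegree-leaf : ∀ c a k →
    colorDegree star c (fsuc k) a ≡ count (c ∘ spoke k) a + count (c ∘ loop k) a * 2
  colorDegree-leaf c a k = trans (colorDegree≡weightedDegree (ends star) c (fsuc k) a) (weightedDegree-leaf (λ e → one-if (c e ≟ⁿ a)) k)

  leaf-spokes-nonconstant : ∀ {t} k → ¬ 2 ∣ t → t < m k →
    ∀ c b → colorDegree star c (fsuc k) b ≡ t → Nonconstant (c ∘ spoke k)
  leaf-spokes-nonconstant {t} k t-odd t<m c b deg≡t =
    odd-count<n⇒nonconstant (c ∘ spoke k) b count-odd (≤-trans (s≤s count≤t) t<m)
    where
    split : count (c ∘ spoke k) b + count (c ∘ loop k) b * 2 ≡ t
    split = trans (sym (colorDegree-leaf c b k)) deg≡t
    count-odd : ¬ 2 ∣ count (c ∘ spoke k) b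
    count-odd 2∣count = t-odd (subst (2 ∣_) split (∣m∣n⇒∣m+n 2∣count (divides (count (c ∘ loop k) b) refl)))
    count≤t : count (c ∘ spoke k) b ≤ t
    count≤t = subst (_ ≤_) split (m≤m+n _ _)

odd-counterexample : ∀ {r t} M Lf Lg → ¬ 2 ∣ t →
  (t + 2) * (t + 1) + M ≡ r → M + Lf * 2 ≡ r → 2 + t + Lg * 2 ≡ r →
  Σ Pseudograph λ G → Fin (nV G) × Regular r G × ¬ Colorable (r ∸ t) t G
odd-counterexample {r} {t} M Lf Lg t-odd r≡ Lf-ok Lg-ok = star , fzero , regular , notColorable
  where
  m l : Fin (suc (suc t)) → ℕ
  m fzero = M
  m (fsuc _) = 2 + t
  l fzero = Lf
  l (fsuc _) = Lg
  open Star m l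

  reorder : ∀ M t → M + suc t * (2 + t) ≡ (t + 2) * (t + 1) + M
  reorder = solve-∀

  centre-excess : ∀ t M → (t + 2) * (t + 1) + M ≡ suc (M + suc t * suc t) + t
  centre-excess = solve-∀

  regular : Regular r star
  regular fzero = trans degree-centre (trans (cong (M +_) (sum-const (suc t) (2 + t))) (trans (reorder M t) r≡))
  regular (fsuc fzero) = trans (degree-leaf fzero) Lf-ok
  regular (fsuc (fsuc i)) = trans (degree-leaf (fsuc i)) Lg-ok

  notColorable : ¬ Colorable (r ∸ t) t star
  notColorable (c , _ , atVertex) with atVertex fzero
  ... | a , _ , _ , centre≡r∸t , _ = n≮n X (subst (_≤ X) r∸t≡ centre≤X)
    where
    X = M + suc t * suc t
    r∸t≡ : r ∸ t ≡ suc X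
    r∸t≡ = trans (cong (_∸ t) (trans (sym r≡) (centre-excess t M))) (m+n∸n≡m (suc X) t)
    gadget≤ : ∀ i → count (c ∘ spoke (fsuc i)) a ≤ suc t
    gadget≤ i with atVertex (fsuc (fsuc i))
    ... | _ , b , _ , _ , leaf≡t
        with leaf-spokes-nonconstant (fsuc i) t-odd (m≤n+m (suc t) 1) c b leaf≡t a
    ... | j , cj≢a = ≤-pred (count<n (c ∘ spoke (fsuc i)) a j cj≢a)
    centre≤X : r ∸ t ≤ X
    centre≤X = begin
      r ∸ t  ≡⟨ sym centre≡r∸t ⟩
      colorDegree star c fzero a  ≡⟨ colorDegree-centre c a ⟩
      count (c ∘ spoke fzero) a + sum (λ i → count (c ∘ spoke (fsuc i)) a)
        ≤⟨ +-mono-≤ (count≤n _ a) (sum-mono gadget≤) ⟩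
      M + sum {suc t} (λ _ → suc t)  ≡⟨ cong (M +_) (sum-const (suc t) (suc t)) ⟩
      X  ∎
      where open ≤-Reasoning

bouquet : ℕ → Pseudograph
bouquet k = graph {1} {k} (λ _ → fzero , fzero)

bouquet-regular : ∀ k → Regular (k * 2) (bouquet k)
bouquet-regular k fzero = trans (sum-map-tabulate {n = k} (incidence (bouquet k) fzero) id) (sum-const k 2)

bouquet-notColorable : ∀ {p t} k → ¬ 2 ∣ t → ¬ Colorable p t (bouquet k)
bouquet-notColorable k t-odd (c , _ , atVertex) with atVertex fzero
... | _ , b , _ , _ , deg≡t = t-odd (subst (2 ∣_) (trans (sym (colorDegree≡weightedDegree (ends (bouquet k)) c fzero b)) deg≡t)
                                      (2∣sum-*2 {k} (λ e → one-if (c e ≟ⁿ b))))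

¬2∣⇒≡1+k*2 : ∀ {n} → ¬ 2 ∣ n → ∃ λ k → n ≡ 1 + k * 2
¬2∣⇒≡1+k*2 {n} ¬2∣n = n / 2 , trans (m≡m%n+[m/n]*n n 2) (cong (_+ n / 2 * 2) n%2≡1)
  where
  n%2≡1 : n % 2 ≡ 1
  n%2≡1 with n % 2 | m%n<n n 2 | m%n≡0⇒n∣m n 2
  ... | 0 | _ | 2∣n = ⊥-elim (¬2∣n (2∣n refl))
  ... | 1 | _ | _ = refl
  ... | suc (suc _) | s≤s (s≤s ()) | _

-- Writing t = 1 + 2s and M = 1 + 2p, the loops needed are (1 + s)(3 + 2s) at leaf 0 and p + 2(1 + s)² at the others.
star-loop-counts : ∀ {r t M} → ¬ 2 ∣ t → ¬ 2 ∣ r → (t + 2) * (t + 1) + M ≡ r →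
  ∃ λ Lf → ∃ λ Lg → M + Lf * 2 ≡ r × 2 + t + Lg * 2 ≡ r
star-loop-counts {r} {t} {M} t-odd r-odd r≡ with ¬2∣⇒≡1+k*2 t-odd
... | s , refl = counts (¬2∣⇒≡1+k*2 M-odd)
  where
  Lf = (1 + s) * (3 + s * 2)

  even-product : ∀ s → (1 + s * 2 + 2) * (1 + s * 2 + 1) ≡ (1 + s) * (3 + s * 2) * 2
  even-product = solve-∀

  M-odd : ¬ 2 ∣ M
  M-odd 2∣M = r-odd (subst (2 ∣_) r≡ (∣m∣n⇒∣m+n (divides Lf (even-product s)) 2∣M))

  leaf-0 : ∀ s p → 1 + p * 2 + (1 + s) * (3 + s * 2) * 2 ≡ (1 + s * 2 + 2) * (1 + s * 2 + 1) + (1 + p * 2)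
  leaf-0 = solve-∀

  other-leaves : ∀ s p →
    2 + (1 + s * 2) + (p + (1 + s) * (1 + s) * 2) * 2 ≡ (1 + s * 2 + 2) * (1 + s * 2 + 1) + (1 + p * 2)
  other-leaves = solve-∀

  counts : (∃ λ p → M ≡ 1 + p * 2) → ∃ λ Lf → ∃ λ Lg → M + Lf * 2 ≡ r × 2 + t + Lg * 2 ≡ r
  counts (p , refl) = Lf , p + (1 + s) * (1 + s) * 2 , trans (leaf-0 s p) r≡ , trans (other-leaves s p) r≡

theorem9 : (r t : ℕ) → 0 < t → 0 < r → 2 * t ≤ r → ¬ (2 ∣ t) →
    (2 ∣ r ⊎ (t + 2) * (t + 1) ≤ r) →
    Σ Pseudograph λ G → Fin (nV G) × Regular r G × ¬ Colorable (r ∸ t) t G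
theorem9 r t _ _ _ t-odd r-even-or-large with 2 ∣? r | r-even-or-large
... | yes (divides k refl) | _ = bouquet k , fzero , bouquet-regular k , bouquet-notColorable k t-odd
... | no r-odd | inj₁ r-even = ⊥-elim (r-odd r-even)
... | no r-odd | inj₂ r-large with m≤n⇒∃[o]m+o≡n r-large
... | M , r≡ with star-loop-counts t-odd r-odd r≡
... | Lf , Lg , Lf-ok , Lg-ok = odd-counterexample M Lf Lg t-odd r≡ Lf-ok Lg-ok
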